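{- For integers $m \ge 0$ and $0 \le r \le m+1$, $$W_{r,m+1}(x) - W_{r,m}(x^2) \equiv 0 \pmod{2^{m+1}}.$$
   Context: For $0 \le r \le m$, $W_{r,m}(x)$ is the weight enumerator $\sum_{c} x^{\mathrm{wt}(c)}$ (Hamming weight) of the binary Reed–Muller code $RM(r,m)$, the length-$2^m$ code of value vectors $(P(a))_{a \in \mathbb{F}_2^m}$ of polynomials $P \in \mathbb{F}_2[y_1,\dots,y_m]$ of degree at most $r$; for $r > m$ one sets $W_{r,m}(x) := W_{m,m}(x) = (1+x)^{2^m}$. Congruence mod an integer is coefficientwise. -}

module Defs where

open import Data.Bool using (Bool; true; false; _∧_; _xor_; if_then_else_)
open import Data.Nat using (ℕ; zero; suc; _≤?_)
open import Data.List using (List; []; _∷_; map; length; filter; deduplicate; _++_; foldr; zipWith)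
open import Data.List.Properties using (≡-dec)
open import Data.Bool.Properties using () renaming (_≟_ to _≟B_)
open import Data.Nat.Properties using (_≟_)

-- all 2^n bit lists of length n (points of F_2^n, or subsets of {1..n})
allBits : ℕ → List (List Bool)
allBits zero = [] ∷ []
allBits (suc n) = map (false ∷_) (allBits n) ++ map (true ∷_) (allBits n)

wt : List Bool → ℕ
wt [] = zero
wt (false ∷ xs) = wt xs
wt (true ∷ xs) = suc (wt xs)

-- squarefree monomials y_S = ∏_{i ∈ S} y_i of degree |S| ≤ r in m variables
monomials : ℕ → ℕ → List (List Bool)
monomials r m = filter (λ S → wt S ≤? r) (allBits m)

evalMono : List Bool → List Bool → Bool
evalMono S a = foldr _∧_ true (zipWith (λ s x → if s then x else true) S a)

-- value at a of the polynomial Σ_j c_j y_{S_j}  (coefficients paired with monomials)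
evalPoly : List Bool → List (List Bool) → List Bool → Bool
evalPoly [] _ a = false
evalPoly (_ ∷ _) [] a = false
evalPoly (c ∷ cs) (S ∷ Ss) a = (c ∧ evalMono S a) xor evalPoly cs Ss a

valueVector : ℕ → List Bool → List (List Bool) → List Bool
valueVector m cs Ss = map (evalPoly cs Ss) (allBits m)

-- the Reed–Muller code RM(r,m): the set (duplicate-free list) of value
-- vectors of all polynomials of degree ≤ r in m variables
RM : ℕ → ℕ → List (List Bool)
RM r m = deduplicate (≡-dec _≟B_)
           (map (λ cs → valueVector m cs (monomials r m))
                (allBits (length (monomials r m))))

-- coefficient of x^k in the weight enumerator W_{r,m}(x)
W : ℕ → ℕ → ℕ → ℕ
W r m k = length (filter (λ c → wt c ≟ k) (RM r m))

-- coefficients of f(x^2) from coefficients of f(x)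
atSquare : (ℕ → ℕ) → ℕ → ℕ
atSquare f zero = f zero
atSquare f (suc zero) = zero
atSquare f (suc (suc k)) = atSquare (λ j → f (suc j)) k

-- A codeword of RM(r, m+1) is (a | a ⊕ R) with a ∈ RM(r, m) and R ∈ RM(r-1, m); its weight is
-- wt a + wt (a ⊕ R).  The words with R = 0 are the (a | a), which give W_{r,m}(x²).  For fixed
-- R ≠ 0 the shifts a ↦ R·l ⊕ a by multiples of affine l preserve RM(r, m) and that weight, so
-- the number of a of each weight is a multiple of the order of this group, which is at least
-- 2^(rank R).  These counts are invariant under translating the variables, and an induction on m
-- that splits R into its two halves shows that any such invariant family sums to a multiple of
-- 2^(m+1) over the nonzero R.

module Submission where

open import Defs
open import Data.Nat using (ℕ; suc; _≤_; _^_)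
open import Data.Integer using (+_; _-_)
open import Data.Integer.Divisibility using (_∣_)

open import Data.Bool using (Bool; true; false; not; _∧_; _xor_; if_then_else_)
open import Data.Bool.Properties
  using (if-∧; if-swap-then; if-not; ∧-conicalˡ; ∧-conicalʳ; ∧-comm; ∧-zeroʳ; ∧-identityʳ;
         xor-comm; xor-assoc; xor-same; xor-identityʳ; ⇔→≡)
  renaming (_≟_ to _≟ᴮ_)
open import Data.Integer using (_⊖_)
open import Data.Integer.Properties using ([+m]-[+n]≡m⊖n; +-cancelˡ-⊖)
open import Data.List using (List; []; _∷_; _++_; map; filter; length; zipWith; deduplicate)
open import Data.List.Membership.Propositional.Properties using (∈-map⁻)
open import Data.List.Properties
  using (filter-++; filter-none; filter-≐; filter-all; ++-identityʳ; length-map; length-++;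
         map-++; map-∘; map-cong; ∷-injective; ∷-injectiveˡ; ∷-injectiveʳ; ≡-dec)
open import Data.List.Relation.Binary.Disjoint.Propositional using (Disjoint)
open import Data.List.Relation.Unary.All using (All; []; _∷_)
import Data.List.Relation.Unary.All as All
import Data.List.Relation.Unary.All.Properties as All
open import Data.List.Relation.Unary.AllPairs using ([]; _∷_)
open import Data.List.Relation.Unary.Unique.Propositional using (Unique)
import Data.List.Relation.Unary.Unique.Propositional.Properties as Unique
open import Data.Nat using (zero; _+_; _*_; _≡ᵇ_; _≤?_; s≤s; s≤s⁻¹)
open import Data.Nat.Divisibility using (∣m∣n⇒∣m+n; *-monoʳ-∣; _∣0; 1∣_) renaming (_∣_ to _∣ℕ_)
open import Data.Nat.ListAction using (sum)
open import Data.Nat.ListAction.Properties using (sum-++)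
open import Data.Nat.Properties
  using (+-commutativeSemigroup; +-comm; +-assoc; +-suc; +-identityʳ; suc-injective; _≟_)
open import Algebra.Properties.CommutativeSemigroup +-commutativeSemigroup using (interchange)
open import Data.Product using (∃; _×_; _,_; proj₁)
open import Data.Vec using (Vec; []; _∷_; replicate)
open import Function using (_∘_; mk⇔)
open import Relation.Binary.PropositionalEquality
open import Relation.Nullary using (does; ¬?)
open import Relation.Unary using (Decidable)
open ≡-Reasoning

variable
  m : ℕ

-- Boolean functions on F₂^m as complete binary trees: node f₀ f₁ is f₀ on y₁ = 0 and f₁ on y₁ = 1,
-- the order in which allBits lists the points.
data Fun : ℕ → Set where
  leaf : Bool → Fun zero
  node : Fun m → Fun m → Fun (suc m)

Point : ℕ → Set
Point = Vec Bool

constant : Bool → Fun m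
constant {zero} b = leaf b
constant {suc m} b = node (constant b) (constant b)

zeros : Fun m
zeros = constant false

infixl 6 _⊕_
infixl 7 _·_

_⊕_ : Fun m → Fun m → Fun m
leaf a ⊕ leaf b = leaf (a xor b)
node a a′ ⊕ node b b′ = node (a ⊕ b) (a′ ⊕ b′)

_·_ : Fun m → Fun m → Fun m
leaf a · leaf b = leaf (a ∧ b)
node a a′ · node b b′ = node (a · b) (a′ · b′)

isZero : Fun m → Bool
isZero (leaf b) = not b
isZero (node a b) = isZero a ∧ isZero b

weight : Fun m → ℕ
weight (leaf false) = 0
weight (leaf true) = 1
weight (node a b) = weight a + weight b

eval : Fun m → Point m → Bool
eval (leaf b) [] = b
eval (node a b) (false ∷ p) = eval a p
eval (node a b) (true ∷ p) = eval b p

translate : Point m → Fun m → Fun m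
translate [] f = f
translate (false ∷ t) (node a b) = node (translate t a) (translate t b)
translate (true ∷ t) (node a b) = node (translate t b) (translate t a)

findOne : Fun m → Point m
findOne (leaf b) = []
findOne (node a b) = if isZero a then true ∷ findOne b else false ∷ findOne a

⊕-comm : (a b : Fun m) → a ⊕ b ≡ b ⊕ a
⊕-comm (leaf a) (leaf b) = cong leaf (xor-comm a b)
⊕-comm (node a a′) (node b b′) = cong₂ node (⊕-comm a b) (⊕-comm a′ b′)

⊕-assoc : (a b c : Fun m) → (a ⊕ b) ⊕ c ≡ a ⊕ (b ⊕ c)
⊕-assoc (leaf a) (leaf b) (leaf c) = cong leaf (xor-assoc a b c)
⊕-assoc (node a a′) (node b b′) (node c c′) = cong₂ node (⊕-assoc a b c) (⊕-assoc a′ b′ c′)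

⊕-identityʳ : (a : Fun m) → a ⊕ zeros ≡ a
⊕-identityʳ (leaf a) = cong leaf (xor-identityʳ a)
⊕-identityʳ (node a b) = cong₂ node (⊕-identityʳ a) (⊕-identityʳ b)

⊕-identityˡ : (a : Fun m) → zeros ⊕ a ≡ a
⊕-identityˡ a = trans (⊕-comm zeros a) (⊕-identityʳ a)

⊕-self : (a : Fun m) → a ⊕ a ≡ zeros
⊕-self (leaf a) = cong leaf (xor-same a)
⊕-self (node a b) = cong₂ node (⊕-self a) (⊕-self b)

⊕-cancelˡ : (a b : Fun m) → a ⊕ (a ⊕ b) ≡ b
⊕-cancelˡ a b = begin
  a ⊕ (a ⊕ b) ≡⟨ ⊕-assoc a a b ⟨
  (a ⊕ a) ⊕ b ≡⟨ cong (_⊕ b) (⊕-self a) ⟩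
  zeros ⊕ b   ≡⟨ ⊕-identityˡ b ⟩
  b           ∎

·-zeroʳ : (a : Fun m) → a · zeros ≡ zeros
·-zeroʳ (leaf a) = cong leaf (∧-zeroʳ a)
·-zeroʳ (node a b) = cong₂ node (·-zeroʳ a) (·-zeroʳ b)

·-zeroˡ : (a : Fun m) → zeros · a ≡ zeros
·-zeroˡ (leaf a) = refl
·-zeroˡ (node a b) = cong₂ node (·-zeroˡ a) (·-zeroˡ b)

·-identityʳ : (a : Fun m) → a · constant true ≡ a
·-identityʳ (leaf a) = cong leaf (∧-identityʳ a)
·-identityʳ (node a b) = cong₂ node (·-identityʳ a) (·-identityʳ b)

isZero-zeros : isZero (zeros {m}) ≡ true
isZero-zeros {zero} = refl
isZero-zeros {suc m} = cong₂ _∧_ (isZero-zeros {m}) (isZero-zeros {m})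

isZero⇒≡zeros : (a : Fun m) → isZero a ≡ true → a ≡ zeros
isZero⇒≡zeros (leaf false) _ = refl
isZero⇒≡zeros (node a b) z =
  cong₂ node (isZero⇒≡zeros a (∧-conicalˡ _ _ z)) (isZero⇒≡zeros b (∧-conicalʳ _ _ z))

eval-⊕ : (a b : Fun m) (p : Point m) → eval (a ⊕ b) p ≡ eval a p xor eval b p
eval-⊕ (leaf a) (leaf b) [] = refl
eval-⊕ (node a a′) (node b b′) (false ∷ p) = eval-⊕ a b p
eval-⊕ (node a a′) (node b b′) (true ∷ p) = eval-⊕ a′ b′ p

eval-· : (a b : Fun m) (p : Point m) → eval (a · b) p ≡ eval a p ∧ eval b p
eval-· (leaf a) (leaf b) [] = refl
eval-· (node a a′) (node b b′) (false ∷ p) = eval-· a b p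
eval-· (node a a′) (node b b′) (true ∷ p) = eval-· a′ b′ p

eval-constant : (c : Bool) (p : Point m) → eval (constant c) p ≡ c
eval-constant c [] = refl
eval-constant c (false ∷ p) = eval-constant c p
eval-constant c (true ∷ p) = eval-constant c p

eval-findOne : (a : Fun m) → isZero a ≡ false → eval a (findOne a) ≡ true
eval-findOne (leaf true) _ = refl
eval-findOne (node a b) nz with isZero a in a0
... | true = eval-findOne b nz
... | false = eval-findOne a a0

translate-zeros : (t : Point m) → translate t zeros ≡ zeros
translate-zeros [] = refl
translate-zeros (false ∷ t) = cong₂ node (translate-zeros t) (translate-zeros t)
translate-zeros (true ∷ t) = cong₂ node (translate-zeros t) (translate-zeros t)

translate-⊕ : (t : Point m) (a b : Fun m) → translate t (a ⊕ b) ≡ translate t a ⊕ translate t b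
translate-⊕ [] a b = refl
translate-⊕ (false ∷ t) (node a a′) (node b b′) = cong₂ node (translate-⊕ t a b) (translate-⊕ t a′ b′)
translate-⊕ (true ∷ t) (node a a′) (node b b′) = cong₂ node (translate-⊕ t a′ b′) (translate-⊕ t a b)

translate-id : (a : Fun m) → translate (replicate m false) a ≡ a
translate-id (leaf b) = refl
translate-id (node a b) = cong₂ node (translate-id a) (translate-id b)

isZero-translate : (t : Point m) (a : Fun m) → isZero (translate t a) ≡ isZero a
isZero-translate [] a = refl
isZero-translate (false ∷ t) (node a b) = cong₂ _∧_ (isZero-translate t a) (isZero-translate t b)
isZero-translate (true ∷ t) (node a b) =
  trans (cong₂ _∧_ (isZero-translate t b) (isZero-translate t a)) (∧-comm (isZero b) (isZero a))

weight-translate : (t : Point m) (a : Fun m) → weight (translate t a) ≡ weight a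
weight-translate [] a = refl
weight-translate (false ∷ t) (node a b) = cong₂ _+_ (weight-translate t a) (weight-translate t b)
weight-translate (true ∷ t) (node a b) =
  trans (cong₂ _+_ (weight-translate t b) (weight-translate t a)) (+-comm (weight b) (weight a))

-- deg<ᵇ r f: f has algebraic degree < r, the zero function having degree −∞; thus deg<ᵇ (suc r)
-- describes RM(r, m).  The node clause is the Plotkin description
-- RM(r, m+1) = {(u | u ⊕ v) : u ∈ RM(r, m), v ∈ RM(r-1, m)}.
deg<ᵇ : ℕ → Fun m → Bool
deg<ᵇ zero f = isZero f
deg<ᵇ (suc r) (leaf _) = true
deg<ᵇ (suc r) (node a b) = deg<ᵇ (suc r) a ∧ deg<ᵇ r (a ⊕ b)

deg<-zeros : ∀ r → deg<ᵇ r (zeros {m}) ≡ true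
deg<-zeros {m} zero = isZero-zeros {m}
deg<-zeros {zero} (suc r) = refl
deg<-zeros {suc m} (suc r) =
  cong₂ _∧_ (deg<-zeros {m} (suc r)) (trans (cong (deg<ᵇ r) (⊕-self zeros)) (deg<-zeros {m} r))

⊕-interchange : (a a′ b b′ : Fun m) → (a ⊕ a′) ⊕ (b ⊕ b′) ≡ (a ⊕ b) ⊕ (a′ ⊕ b′)
⊕-interchange a a′ b b′ = begin
  (a ⊕ a′) ⊕ (b ⊕ b′) ≡⟨ ⊕-assoc a a′ (b ⊕ b′) ⟩
  a ⊕ (a′ ⊕ (b ⊕ b′)) ≡⟨ cong (a ⊕_) (⊕-assoc a′ b b′) ⟨
  a ⊕ ((a′ ⊕ b) ⊕ b′) ≡⟨ cong (λ f → a ⊕ (f ⊕ b′)) (⊕-comm a′ b) ⟩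
  a ⊕ ((b ⊕ a′) ⊕ b′) ≡⟨ cong (a ⊕_) (⊕-assoc b a′ b′) ⟩
  a ⊕ (b ⊕ (a′ ⊕ b′)) ≡⟨ ⊕-assoc a b (a′ ⊕ b′) ⟨
  (a ⊕ b) ⊕ (a′ ⊕ b′) ∎

deg<-⊕ : ∀ r (a b : Fun m) → deg<ᵇ r a ≡ true → deg<ᵇ r b ≡ true → deg<ᵇ r (a ⊕ b) ≡ true
deg<-⊕ {m} zero a b ha hb rewrite isZero⇒≡zeros a ha | isZero⇒≡zeros b hb | ⊕-self (zeros {m}) =
  isZero-zeros {m}
deg<-⊕ (suc r) (leaf _) (leaf _) _ _ = refl
deg<-⊕ (suc r) (node a a′) (node b b′) ha hb =
  cong₂ _∧_ (deg<-⊕ (suc r) a b (∧-conicalˡ _ _ ha) (∧-conicalˡ _ _ hb))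
            (subst (λ f → deg<ᵇ r f ≡ true) (⊕-interchange a a′ b b′)
                   (deg<-⊕ r (a ⊕ a′) (b ⊕ b′) (∧-conicalʳ _ _ ha) (∧-conicalʳ _ _ hb)))

deg<-suc : ∀ r (a : Fun m) → deg<ᵇ r a ≡ true → deg<ᵇ (suc r) a ≡ true
deg<-suc {m} zero a h rewrite isZero⇒≡zeros a h = deg<-zeros {m} 1
deg<-suc (suc r) (leaf _) _ = refl
deg<-suc (suc r) (node a b) h =
  cong₂ _∧_ (deg<-suc (suc r) a (∧-conicalˡ _ _ h)) (deg<-suc r (a ⊕ b) (∧-conicalʳ _ _ h))

deg<-⊕-invariant : ∀ r (v a : Fun m) → deg<ᵇ r v ≡ true → deg<ᵇ r (v ⊕ a) ≡ deg<ᵇ r a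
deg<-⊕-invariant r v a hv = ⇔→≡ (mk⇔
  (λ h → subst (λ f → deg<ᵇ r f ≡ true) (⊕-cancelˡ v a) (deg<-⊕ r v (v ⊕ a) hv h))
  (deg<-⊕ r v a hv))

deg<-node-diag : ∀ r (a : Fun m) → deg<ᵇ (suc r) a ≡ true → deg<ᵇ (suc r) (node a a) ≡ true
deg<-node-diag r a h = cong₂ _∧_ h (trans (cong (deg<ᵇ r) (⊕-self a)) (deg<-zeros r))

deg<-constant : ∀ r (c : Bool) → deg<ᵇ (suc r) (constant {m} c) ≡ true
deg<-constant {zero} r c = refl
deg<-constant {suc m} r c = deg<-node-diag r (constant {m} c) (deg<-constant {m} r c)

deg<1⇒constant : (e : Fun m) → deg<ᵇ 1 e ≡ true → ∃ λ c → e ≡ constant c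
deg<1⇒constant (leaf c) _ = c , refl
deg<1⇒constant (node a b) h with deg<1⇒constant a (∧-conicalˡ _ _ h)
... | c , refl = c , cong (node (constant c)) (begin
  b                             ≡⟨ ⊕-cancelˡ (constant c) b ⟨
  constant c ⊕ (constant c ⊕ b) ≡⟨ cong (constant c ⊕_) (isZero⇒≡zeros _ (∧-conicalʳ _ _ h)) ⟩
  constant c ⊕ zeros            ≡⟨ ⊕-identityʳ (constant c) ⟩
  constant c                    ∎)

deg<-·-constant : ∀ r (a e : Fun m) → deg<ᵇ r a ≡ true → deg<ᵇ 1 e ≡ true → deg<ᵇ r (a · e) ≡ true
deg<-·-constant r a e ha he with deg<1⇒constant e he
... | true , refl = subst (λ f → deg<ᵇ r f ≡ true) (sym (·-identityʳ a)) ha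
... | false , refl = subst (λ f → deg<ᵇ r f ≡ true) (sym (·-zeroʳ a)) (deg<-zeros r)

-- Expresses the difference of the halves of (x | y) · (a | b) through x ⊕ y and a ⊕ b.
·-⊕-expand : (x y a b : Fun m) → x · a ⊕ y · b ≡ (x · (a ⊕ b) ⊕ (x ⊕ y) · a) ⊕ (x ⊕ y) · (a ⊕ b)
·-⊕-expand (leaf x) (leaf y) (leaf a) (leaf b) = cong leaf (expand x y a b)
  where
  expand : ∀ x y a b →
    (x ∧ a) xor (y ∧ b) ≡ ((x ∧ (a xor b)) xor ((x xor y) ∧ a)) xor ((x xor y) ∧ (a xor b))
  expand false false a b = refl
  expand false true false false = refl
  expand false true false true = refl
  expand false true true false = refl
  expand false true true true = refl
  expand true false false false = refl
  expand true false false true = refl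
  expand true false true false = refl
  expand true false true true = refl
  expand true true false false = refl
  expand true true false true = refl
  expand true true true false = refl
  expand true true true true = refl
·-⊕-expand (node x x′) (node y y′) (node a a′) (node b b′) =
  cong₂ node (·-⊕-expand x y a b) (·-⊕-expand x′ y′ a′ b′)

deg<-· : ∀ r (R l : Fun m) → deg<ᵇ r R ≡ true → deg<ᵇ 2 l ≡ true → deg<ᵇ (suc r) (R · l) ≡ true
deg<-· {zero} r (leaf _) (leaf _) _ _ = refl
deg<-· {suc m} zero R l hR _ rewrite isZero⇒≡zeros R hR | ·-zeroˡ l = deg<-zeros {suc m} 1
deg<-· {suc m} (suc r) (node x y) (node a b) hR hl =
  cong₂ _∧_ (deg<-· (suc r) x a hx ha)
    (subst (λ f → deg<ᵇ (suc r) f ≡ true) (sym (·-⊕-expand x y a b))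
      (deg<-⊕ (suc r) (x · (a ⊕ b) ⊕ (x ⊕ y) · a) ((x ⊕ y) · (a ⊕ b))
        (deg<-⊕ (suc r) (x · (a ⊕ b)) ((x ⊕ y) · a)
          (deg<-·-constant (suc r) x (a ⊕ b) hx hab) (deg<-· r (x ⊕ y) a hxy ha))
        (deg<-suc r ((x ⊕ y) · (a ⊕ b)) (deg<-·-constant r (x ⊕ y) (a ⊕ b) hxy hab))))
  where
  hx : deg<ᵇ (suc r) x ≡ true
  hx = ∧-conicalˡ _ _ hR
  hxy : deg<ᵇ r (x ⊕ y) ≡ true
  hxy = ∧-conicalʳ _ _ hR
  ha : deg<ᵇ 2 a ≡ true
  ha = ∧-conicalˡ _ _ hl
  hab : deg<ᵇ 1 (a ⊕ b) ≡ true
  hab = ∧-conicalʳ _ _ hl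

deg<-node-swap : ∀ r (a b : Fun m) → deg<ᵇ (suc r) (node a b) ≡ deg<ᵇ (suc r) (node b a)
deg<-node-swap r a b = ⇔→≡ (mk⇔ (swap a b) (swap b a))
  where
  swap : ∀ a b → deg<ᵇ (suc r) (node a b) ≡ true → deg<ᵇ (suc r) (node b a) ≡ true
  swap a b h = cong₂ _∧_
    (subst (λ f → deg<ᵇ (suc r) f ≡ true) (⊕-cancelˡ a b)
      (deg<-⊕ (suc r) a (a ⊕ b) (∧-conicalˡ _ _ h) (deg<-suc r (a ⊕ b) (∧-conicalʳ _ _ h))))
    (subst (λ f → deg<ᵇ r f ≡ true) (⊕-comm a b) (∧-conicalʳ _ _ h))

deg<-translate : ∀ r (t : Point m) (a : Fun m) → deg<ᵇ r (translate t a) ≡ deg<ᵇ r a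
deg<-translate zero t a = isZero-translate t a
deg<-translate (suc r) [] a = refl
deg<-translate (suc r) (false ∷ t) (node a b) =
  cong₂ _∧_ (deg<-translate (suc r) t a) (difference t a b)
  where
  difference : ∀ t a b → deg<ᵇ r (translate t a ⊕ translate t b) ≡ deg<ᵇ r (a ⊕ b)
  difference t a b = trans (cong (deg<ᵇ r) (sym (translate-⊕ t a b))) (deg<-translate r t (a ⊕ b))
deg<-translate (suc r) (true ∷ t) (node a b) =
  trans (cong₂ _∧_ (deg<-translate (suc r) t b) (difference t b a)) (deg<-node-swap r b a)
  where
  difference : ∀ t a b → deg<ᵇ r (translate t a ⊕ translate t b) ≡ deg<ᵇ r (a ⊕ b)
  difference t a b = trans (cong (deg<ᵇ r) (sym (translate-⊕ t a b))) (deg<-translate r t (a ⊕ b))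

-- Sums over Boolean functions

∑ : (m : ℕ) → (Fun m → ℕ) → ℕ
∑ zero f = f (leaf false) + f (leaf true)
∑ (suc m) f = ∑ m (λ a → ∑ m (λ b → f (node a b)))

∑-cong : ∀ m {f g : Fun m → ℕ} → (∀ x → f x ≡ g x) → ∑ m f ≡ ∑ m g
∑-cong zero eq = cong₂ _+_ (eq _) (eq _)
∑-cong (suc m) eq = ∑-cong m (λ a → ∑-cong m (λ b → eq (node a b)))

∑-zero : ∀ m → ∑ m (λ _ → 0) ≡ 0
∑-zero zero = refl
∑-zero (suc m) = trans (∑-cong m (λ _ → ∑-zero m)) (∑-zero m)

∑-+ : ∀ m (f g : Fun m → ℕ) → ∑ m (λ x → f x + g x) ≡ ∑ m f + ∑ m g
∑-+ zero f g = interchange (f (leaf false)) (g (leaf false)) (f (leaf true)) (g (leaf true))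
∑-+ (suc m) f g =
  trans (∑-cong m (λ a → ∑-+ m (λ b → f (node a b)) (λ b → g (node a b)))) (∑-+ m _ _)

∑-comm : ∀ m n (f : Fun m → Fun n → ℕ) →
  ∑ m (λ a → ∑ n (λ b → f a b)) ≡ ∑ n (λ b → ∑ m (λ a → f a b))
∑-comm zero n f = sym (∑-+ n (f (leaf false)) (f (leaf true)))
∑-comm (suc m) n f = begin
  ∑ m (λ a₀ → ∑ m (λ a₁ → ∑ n (λ b → f (node a₀ a₁) b)))
    ≡⟨ ∑-cong m (λ a₀ → ∑-comm m n (λ a₁ → f (node a₀ a₁))) ⟩
  ∑ m (λ a₀ → ∑ n (λ b → ∑ m (λ a₁ → f (node a₀ a₁) b)))
    ≡⟨ ∑-comm m n (λ a₀ b → ∑ m (λ a₁ → f (node a₀ a₁) b)) ⟩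
  ∑ n (λ b → ∑ m (λ a₀ → ∑ m (λ a₁ → f (node a₀ a₁) b))) ∎

∑-⊕ : ∀ m (v : Fun m) (f : Fun m → ℕ) → ∑ m (λ x → f (v ⊕ x)) ≡ ∑ m f
∑-⊕ zero (leaf false) f = refl
∑-⊕ zero (leaf true) f = +-comm (f (leaf true)) (f (leaf false))
∑-⊕ (suc m) (node v₀ v₁) f =
  trans (∑-cong m (λ a → ∑-⊕ m v₁ (λ b → f (node (v₀ ⊕ a) b))))
        (∑-⊕ m v₀ (λ a → ∑ m (λ b → f (node a b))))

∑-translate : ∀ m (t : Point m) (f : Fun m → ℕ) → ∑ m (λ x → f (translate t x)) ≡ ∑ m f
∑-translate zero [] f = refl
∑-translate (suc m) (false ∷ t) f =
  trans (∑-cong m (λ a → ∑-translate m t (λ b → f (node (translate t a) b))))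
        (∑-translate m t (λ a → ∑ m (λ b → f (node a b))))
∑-translate (suc m) (true ∷ t) f = begin
  ∑ m (λ a → ∑ m (λ b → f (node (translate t b) (translate t a))))
    ≡⟨ ∑-cong m (λ a → ∑-translate m t (λ b → f (node b (translate t a)))) ⟩
  ∑ m (λ a → ∑ m (λ b → f (node b (translate t a))))
    ≡⟨ ∑-translate m t (λ a → ∑ m (λ b → f (node b a))) ⟩
  ∑ m (λ a → ∑ m (λ b → f (node b a)))
    ≡⟨ ∑-comm m m (λ a b → f (node b a)) ⟩
  ∑ m (λ b → ∑ m (λ a → f (node b a))) ∎

∑-∣ : ∀ m {d} (f : Fun m → ℕ) → (∀ x → d ∣ℕ f x) → d ∣ℕ ∑ m f
∑-∣ zero f h = ∣m∣n⇒∣m+n (h _) (h _)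
∑-∣ (suc m) f h = ∑-∣ m _ (λ a → ∑-∣ m _ (λ b → h (node a b)))

∑-if : ∀ m (c : Bool) (f : Fun m → ℕ) →
  ∑ m (λ x → if c then f x else 0) ≡ (if c then ∑ m f else 0)
∑-if m true f = refl
∑-if m false f = ∑-zero m

∑-atZero : ∀ m (f : Fun m → ℕ) → ∑ m (λ x → if isZero x then f x else 0) ≡ f zeros
∑-atZero zero f = +-identityʳ _
∑-atZero (suc m) f = begin
  ∑ m (λ a → ∑ m (λ b → if isZero a ∧ isZero b then f (node a b) else 0))
    ≡⟨ ∑-cong m (λ a → ∑-cong m (λ b → if-∧ (isZero a))) ⟩
  ∑ m (λ a → ∑ m (λ b → if isZero a then (if isZero b then f (node a b) else 0) else 0))
    ≡⟨ ∑-cong m (λ a → ∑-if m (isZero a) _) ⟩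
  ∑ m (λ a → if isZero a then ∑ m (λ b → if isZero b then f (node a b) else 0) else 0)
    ≡⟨ ∑-cong m (λ a → cong (λ n → if isZero a then n else 0) (∑-atZero m (λ b → f (node a b)))) ⟩
  ∑ m (λ a → if isZero a then f (node a zeros) else 0)
    ≡⟨ ∑-atZero m (λ a → f (node a zeros)) ⟩
  f zeros ∎

∑-partition : ∀ m (c : Fun m → Bool) (f : Fun m → ℕ) →
  ∑ m f ≡ ∑ m (λ x → if c x then f x else 0) + ∑ m (λ x → if c x then 0 else f x)
∑-partition m c f = trans (∑-cong m (λ x → split (c x) (f x))) (∑-+ m _ _)
  where
  split : ∀ b n → n ≡ (if b then n else 0) + (if b then 0 else n)
  split true n = sym (+-identityʳ n)
  split false n = refl

∑-split : ∀ m (f : Fun m → ℕ) → ∑ m f ≡ f zeros + ∑ m (λ x → if isZero x then 0 else f x)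
∑-split m f =
  trans (∑-partition m isZero f) (cong (_+ ∑ m (λ x → if isZero x then 0 else f x)) (∑-atZero m f))

∑deg< : ℕ → (m : ℕ) → (Fun m → ℕ) → ℕ
∑deg< r m f = ∑ m (λ x → if deg<ᵇ r x then f x else 0)

∑deg<-cong : ∀ r m {f g : Fun m → ℕ} → (∀ x → f x ≡ g x) → ∑deg< r m f ≡ ∑deg< r m g
∑deg<-cong r m eq = ∑-cong m (λ x → cong (λ n → if deg<ᵇ r x then n else 0) (eq x))

∑deg<-comm : ∀ r s m n (f : Fun m → Fun n → ℕ) →
  ∑deg< r m (λ a → ∑deg< s n (λ b → f a b)) ≡ ∑deg< s n (λ b → ∑deg< r m (λ a → f a b))
∑deg<-comm r s m n f = begin
  ∑ m (λ a → if deg<ᵇ r a then ∑deg< s n (f a) else 0)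
    ≡⟨ ∑-cong m (λ a → sym (∑-if n (deg<ᵇ r a) _)) ⟩
  ∑ m (λ a → ∑ n (λ b → if deg<ᵇ r a then (if deg<ᵇ s b then f a b else 0) else 0))
    ≡⟨ ∑-comm m n _ ⟩
  ∑ n (λ b → ∑ m (λ a → if deg<ᵇ r a then (if deg<ᵇ s b then f a b else 0) else 0))
    ≡⟨ ∑-cong n (λ b → ∑-cong m (λ a → if-swap-then (deg<ᵇ r a) (deg<ᵇ s b))) ⟩
  ∑ n (λ b → ∑ m (λ a → if deg<ᵇ s b then (if deg<ᵇ r a then f a b else 0) else 0))
    ≡⟨ ∑-cong n (λ b → ∑-if m (deg<ᵇ s b) _) ⟩
  ∑ n (λ b → if deg<ᵇ s b then ∑deg< r m (λ a → f a b) else 0) ∎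

∑deg<-plotkin : ∀ r m (f : Fun (suc m) → ℕ) →
  ∑deg< (suc r) (suc m) f ≡ ∑deg< (suc r) m (λ a → ∑deg< r m (λ b → f (node a (a ⊕ b))))
∑deg<-plotkin r m f = ∑-cong m (λ a → begin
  ∑ m (λ b → if deg<ᵇ (suc r) a ∧ deg<ᵇ r (a ⊕ b) then f (node a b) else 0)
    ≡⟨ ∑-⊕ m a _ ⟨
  ∑ m (λ b → if deg<ᵇ (suc r) a ∧ deg<ᵇ r (a ⊕ (a ⊕ b)) then f (node a (a ⊕ b)) else 0)
    ≡⟨ ∑-cong m (λ b → cong (λ c → if deg<ᵇ (suc r) a ∧ deg<ᵇ r c then f (node a (a ⊕ b)) else 0)
                            (⊕-cancelˡ a b)) ⟩
  ∑ m (λ b → if deg<ᵇ (suc r) a ∧ deg<ᵇ r b then f (node a (a ⊕ b)) else 0)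
    ≡⟨ ∑-cong m (λ b → if-∧ (deg<ᵇ (suc r) a)) ⟩
  ∑ m (λ b → if deg<ᵇ (suc r) a then (if deg<ᵇ r b then f (node a (a ⊕ b)) else 0) else 0)
    ≡⟨ ∑-if m (deg<ᵇ (suc r) a) _ ⟩
  (if deg<ᵇ (suc r) a then ∑deg< r m (λ b → f (node a (a ⊕ b))) else 0) ∎)

-- Shifts by the multiples R · l of affine l

∑-halve : ∀ m (v : Fun m) (p : Point m) → eval v p ≡ true →
  (g : Fun m → ℕ) → (∀ x → g (v ⊕ x) ≡ g x) →
  ∑ m g ≡ ∑ m (λ x → if eval x p then 0 else g x) + ∑ m (λ x → if eval x p then 0 else g x)
∑-halve m v p vp g inv = begin
  ∑ m g                                                         ≡⟨ ∑-partition m (λ x → eval x p) g ⟩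
  ∑ m (λ x → if eval x p then g x else 0) + ∑ m off             ≡⟨ cong (_+ ∑ m off) (∑-⊕ m v _) ⟨
  ∑ m (λ x → if eval (v ⊕ x) p then g (v ⊕ x) else 0) + ∑ m off ≡⟨ cong (_+ ∑ m off) (∑-cong m flip) ⟩
  ∑ m off + ∑ m off                                             ∎
  where
  off : Fun m → ℕ
  off x = if eval x p then 0 else g x
  flip : ∀ x → (if eval (v ⊕ x) p then g (v ⊕ x) else 0) ≡ off x
  flip x rewrite eval-⊕ v x p | vp | inv x = if-not (eval x p)

∣-double : ∀ {d} n → d ∣ℕ n → 2 * d ∣ℕ n + n
∣-double {d} n h = subst (2 * d ∣ℕ_) (cong (λ k → n + k) (+-identityʳ n)) (*-monoʳ-∣ 2 h)

-- A lower bound for the dimension of R · RM(1, m): if both halves a, b of R are nonzero, these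
-- multiples project onto those of a, and R · (0 | 1) = (0 | b) is a nonzero one in the kernel.
rank : Fun m → ℕ
rank (leaf c) = if c then 1 else 0
rank (node a b) = if isZero b then rank a else if isZero a then rank b else suc (rank a)

Invariant-·RM₁ : Fun m → (Fun m → ℕ) → Set
Invariant-·RM₁ R h = ∀ l → deg<ᵇ 2 l ≡ true → ∀ Q → h (R · l ⊕ Q) ≡ h Q

deg<-node-⊕constant : (l : Fun m) (c : Bool) →
  deg<ᵇ 2 l ≡ true → deg<ᵇ 2 (node l (l ⊕ constant c)) ≡ true
deg<-node-⊕constant {m} l c h =
  cong₂ _∧_ h (trans (cong (deg<ᵇ 1) (⊕-cancelˡ l (constant c))) (deg<-constant {m} 0 c))

·-⊕-vanishing : (b l d : Fun m) → isZero b ≡ true → b · l ⊕ d ≡ d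
·-⊕-vanishing b l d b0 = begin
  b · l ⊕ d     ≡⟨ cong (λ z → z · l ⊕ d) (isZero⇒≡zeros b b0) ⟩
  zeros · l ⊕ d ≡⟨ cong (_⊕ d) (·-zeroˡ l) ⟩
  zeros ⊕ d     ≡⟨ ⊕-identityˡ d ⟩
  d             ∎

Invariant-·RM₁-sliceˡ : (a b : Fun m) (h : Fun (suc m) → ℕ) → Invariant-·RM₁ (node a b) h →
  isZero b ≡ true → ∀ d → Invariant-·RM₁ a (λ c → h (node c d))
Invariant-·RM₁-sliceˡ a b h inv b0 d l hl c = begin
  h (node (a · l ⊕ c) d)           ≡⟨ cong (λ e → h (node (a · l ⊕ c) e)) (·-⊕-vanishing b l d b0) ⟨
  h (node (a · l ⊕ c) (b · l ⊕ d)) ≡⟨ inv (node l l) (deg<-node-diag 1 l hl) (node c d) ⟩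
  h (node c d)                     ∎

Invariant-·RM₁-sliceʳ : (a b : Fun m) (h : Fun (suc m) → ℕ) → Invariant-·RM₁ (node a b) h →
  isZero a ≡ true → ∀ c → Invariant-·RM₁ b (λ d → h (node c d))
Invariant-·RM₁-sliceʳ a b h inv a0 c l hl d = begin
  h (node c (b · l ⊕ d))           ≡⟨ cong (λ e → h (node e (b · l ⊕ d))) (·-⊕-vanishing a l c a0) ⟨
  h (node (a · l ⊕ c) (b · l ⊕ d)) ≡⟨ inv (node l l) (deg<-node-diag 1 l hl) (node c d) ⟩
  h (node c d)                     ∎

halfSum : Point m → (Fun (suc m) → ℕ) → Fun m → ℕ
halfSum {m} p h c = ∑ m (λ d → if eval d p then 0 else h (node c d))

∑-halfSum : (a b : Fun m) (p : Point m) (h : Fun (suc m) → ℕ) → Invariant-·RM₁ (node a b) h →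
  eval b p ≡ true → ∑ (suc m) h ≡ ∑ m (halfSum p h) + ∑ m (halfSum p h)
∑-halfSum {m} a b p h inv bp =
  trans (∑-cong m (λ c → ∑-halve m b p bp (λ d → h (node c d)) (pairing c))) (∑-+ m _ _)
  where
  pairing : ∀ c d → h (node c (b ⊕ d)) ≡ h (node c d)
  pairing c d = begin
    h (node c (b ⊕ d))
      ≡⟨ cong₂ (λ x y → h (node x y)) left right ⟨
    h (node (a · zeros ⊕ c) (b · (zeros ⊕ constant true) ⊕ d))
      ≡⟨ inv (node zeros (zeros ⊕ constant true))
             (deg<-node-⊕constant (zeros {m}) true (deg<-zeros {m} 2)) (node c d) ⟩
    h (node c d) ∎
    where
    left : a · zeros ⊕ c ≡ c
    left = trans (cong (_⊕ c) (·-zeroʳ a)) (⊕-identityˡ c)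
    right : b · (zeros ⊕ constant true) ⊕ d ≡ b ⊕ d
    right = cong (_⊕ d) (trans (cong (b ·_) (⊕-identityˡ _)) (·-identityʳ b))

-- The shift by (a | b) · (l | l ⊕ l p) acts on the left half as a · l and moves d only by a
-- function vanishing at p.
Invariant-·RM₁-halfSum : (a b : Fun m) (p : Point m) (h : Fun (suc m) → ℕ) →
  Invariant-·RM₁ (node a b) h → Invariant-·RM₁ a (halfSum p h)
Invariant-·RM₁-halfSum {m} a b p h inv l hl c = begin
  ∑ m (λ d → if eval d p then 0 else h (node (a · l ⊕ c) d))
    ≡⟨ ∑-cong m (λ d → cong (if eval d p then 0 else_) (moved d)) ⟩
  ∑ m (λ d → if eval d p then 0 else h (node c (s ⊕ d)))
    ≡⟨ ∑-cong m (λ d → cong (λ e → if e then 0 else h (node c (s ⊕ d))) (eval-s⊕ d)) ⟨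
  ∑ m (λ d → if eval (s ⊕ d) p then 0 else h (node c (s ⊕ d)))
    ≡⟨ ∑-⊕ m s (λ d → if eval d p then 0 else h (node c d)) ⟩
  halfSum p h c ∎
  where
  l′ : Fun m
  l′ = l ⊕ constant (eval l p)
  s : Fun m
  s = b · l′
  moved : ∀ d → h (node (a · l ⊕ c) d) ≡ h (node c (s ⊕ d))
  moved d = begin
    h (node (a · l ⊕ c) d)
      ≡⟨ cong (λ e → h (node (a · l ⊕ c) e)) (⊕-cancelˡ s d) ⟨
    h (node (a · l ⊕ c) (s ⊕ (s ⊕ d)))
      ≡⟨ inv (node l l′) (deg<-node-⊕constant l (eval l p) hl) (node c (s ⊕ d)) ⟩
    h (node c (s ⊕ d)) ∎
  eval-s⊕ : ∀ d → eval (s ⊕ d) p ≡ eval d p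
  eval-s⊕ d rewrite eval-⊕ s d p | eval-· b l′ p | eval-⊕ l (constant (eval l p)) p
                  | eval-constant (eval l p) p | xor-same (eval l p) | ∧-zeroʳ (eval b p) = refl

2^rank∣∑ : (R : Fun m) (h : Fun m → ℕ) → Invariant-·RM₁ R h → 2 ^ rank R ∣ℕ ∑ m h
2^rank∣∑ (leaf false) h _ = 1∣ _
2^rank∣∑ (leaf true) h inv =
  subst (2 ∣ℕ_) (cong (λ k → h (leaf false) + k) (sym (inv (leaf true) refl (leaf false))))
        (∣-double (h (leaf false)) (1∣ _))
2^rank∣∑ {suc m} (node a b) h inv with isZero b in b0 | isZero a in a0
... | true | _ =
  subst (2 ^ rank a ∣ℕ_) (∑-comm m m (λ d c → h (node c d)))
        (∑-∣ m _ (λ d → 2^rank∣∑ a (λ c → h (node c d)) (Invariant-·RM₁-sliceˡ a b h inv b0 d)))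
... | false | true = ∑-∣ m _ (λ c → 2^rank∣∑ b (λ d → h (node c d)) (Invariant-·RM₁-sliceʳ a b h inv a0 c))
... | false | false =
  subst (2 * 2 ^ rank a ∣ℕ_) (sym (∑-halfSum a b p h inv (eval-findOne b b0)))
        (∣-double _ (2^rank∣∑ a (halfSum p h) (Invariant-·RM₁-halfSum a b p h inv)))
  where
  p : Point m
  p = findOne b

-- Sums of translation-invariant functions

TranslationInvariant : (Fun m → ℕ) → Set
TranslationInvariant {m} φ = ∀ (t : Point m) R → φ (translate t R) ≡ φ R

onLeftAxis : (Fun (suc m) → ℕ) → Fun m → ℕ
onLeftAxis φ a = φ (node a zeros)

offAxes : (Fun (suc m) → ℕ) → Fun m → ℕ
offAxes {m} φ a = if isZero a then 0 else ∑ m (λ b → if isZero b then 0 else φ (node a b))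

-- The translation swapping the halves turns the terms with a = 0 into a second copy of those with b = 0.
∑-axes : ∀ m (φ : Fun (suc m) → ℕ) → φ zeros ≡ 0 → TranslationInvariant φ →
  ∑ (suc m) φ ≡ ∑ m (onLeftAxis φ) + (∑ m (onLeftAxis φ) + ∑ m (offAxes φ))
∑-axes m φ φ0 inv = begin
  ∑ m (λ a → ∑ m (λ b → φ (node a b)))   ≡⟨ ∑-cong m (λ a → ∑-split m (λ b → φ (node a b))) ⟩
  ∑ m (λ a → ψ a + χ a)                  ≡⟨ ∑-+ m ψ χ ⟩
  ∑ m ψ + ∑ m χ                          ≡⟨ cong (λ n → ∑ m ψ + n) (∑-split m χ) ⟩
  ∑ m ψ + (χ zeros + ∑ m (offAxes φ))    ≡⟨ cong (λ n → ∑ m ψ + (n + ∑ m (offAxes φ))) χ-zeros ⟩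
  ∑ m ψ + (∑ m ψ + ∑ m (offAxes φ))      ∎
  where
  ψ : Fun m → ℕ
  ψ = onLeftAxis φ
  χ : Fun m → ℕ
  χ a = ∑ m (λ b → if isZero b then 0 else φ (node a b))
  swap : ∀ b → φ (node zeros b) ≡ ψ b
  swap b = begin
    φ (node zeros b)
      ≡⟨ inv (true ∷ replicate m false) (node zeros b) ⟨
    φ (node (translate (replicate m false) b) (translate (replicate m false) zeros))
      ≡⟨ cong₂ (λ x y → φ (node x y)) (translate-id b) (translate-id zeros) ⟩
    ψ b ∎
  χ-zeros : χ zeros ≡ ∑ m ψ
  χ-zeros = begin
    χ zeros
      ≡⟨ ∑-cong m (λ b → cong (if isZero b then 0 else_) (swap b)) ⟩
    ∑ m (λ b → if isZero b then 0 else ψ b)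
      ≡⟨ cong (_+ ∑ m (λ b → if isZero b then 0 else ψ b)) φ0 ⟨
    ψ zeros + ∑ m (λ b → if isZero b then 0 else ψ b)
      ≡⟨ ∑-split m ψ ⟨
    ∑ m ψ ∎

onLeftAxis-invariant : (φ : Fun (suc m) → ℕ) → TranslationInvariant φ → TranslationInvariant (onLeftAxis φ)
onLeftAxis-invariant φ inv t R =
  trans (cong (λ z → φ (node (translate t R) z)) (sym (translate-zeros t))) (inv (false ∷ t) (node R zeros))

offAxes-invariant : (φ : Fun (suc m) → ℕ) → TranslationInvariant φ → TranslationInvariant (offAxes φ)
offAxes-invariant {m} φ inv t R = cong₂ (λ z n → if z then 0 else n) (isZero-translate t R) (begin
  ∑ m (λ b → if isZero b then 0 else φ (node (translate t R) b))
    ≡⟨ ∑-translate m t _ ⟨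
  ∑ m (λ b → if isZero (translate t b) then 0 else φ (node (translate t R) (translate t b)))
    ≡⟨ ∑-cong m (λ b → cong₂ (λ z n → if z then 0 else n)
                             (isZero-translate t b) (inv (false ∷ t) (node R b))) ⟩
  ∑ m (λ b → if isZero b then 0 else φ (node R b)) ∎)

-- By ∑-axes, with the two copies of ∑ (onLeftAxis φ) supplying one factor 2 and
-- rank (a | b) = 1 + rank a for a, b ≠ 0 supplying it for offAxes φ.
2^[j+1+m]∣∑ : ∀ m j (φ : Fun m → ℕ) → φ zeros ≡ 0 → TranslationInvariant φ →
  (∀ R → isZero R ≡ false → 2 ^ (j + rank R) ∣ℕ φ R) → 2 ^ (j + suc m) ∣ℕ ∑ m φ
2^[j+1+m]∣∑ zero j φ φ0 _ div rewrite φ0 = div (leaf true) refl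
2^[j+1+m]∣∑ (suc m) j φ φ0 inv div
  rewrite ∑-axes m φ φ0 inv | sym (+-assoc (∑ m (onLeftAxis φ)) (∑ m (onLeftAxis φ)) (∑ m (offAxes φ)))
        | +-suc j (suc m) =
  ∣m∣n⇒∣m+n (∣-double _ (2^[j+1+m]∣∑ m j (onLeftAxis φ) φ0 (onLeftAxis-invariant φ inv) onLeftAxis-divisible))
            (2^[j+1+m]∣∑ m (suc j) (offAxes φ) offAxes-zeros (offAxes-invariant φ inv) offAxes-divisible)
  where
  onLeftAxis-divisible : ∀ R → isZero R ≡ false → 2 ^ (j + rank R) ∣ℕ onLeftAxis φ R
  onLeftAxis-divisible R nz with div (node R zeros) (cong (_∧ isZero (zeros {m})) nz)
  ... | d rewrite isZero-zeros {m} = d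

  offAxes-zeros : offAxes φ zeros ≡ 0
  offAxes-zeros rewrite isZero-zeros {m} = refl

  offAxes-divisible : ∀ R → isZero R ≡ false → 2 ^ (suc j + rank R) ∣ℕ offAxes φ R
  offAxes-divisible R nz rewrite nz = ∑-∣ m _ term
    where
    term : ∀ b → 2 ^ (suc j + rank R) ∣ℕ (if isZero b then 0 else φ (node R b))
    term b with isZero b in nzb
    ... | true = _ ∣0
    ... | false with div (node R b) (cong₂ _∧_ nz nzb)
    ... | d rewrite nz | nzb | +-suc j (rank R) = d

-- The Plotkin decomposition of the weight distribution

⟦_⟧ : Bool → ℕ
⟦ true ⟧ = 1
⟦ false ⟧ = 0

-- Where R = l = 1 the two halves exchange their values; everywhere else nothing changes.
weight-plotkin-invariant : (R l Q : Fun m) →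
  weight (node (R · l ⊕ Q) (R · l ⊕ Q ⊕ R)) ≡ weight (node Q (Q ⊕ R))
weight-plotkin-invariant (leaf false) (leaf l) (leaf false) = refl
weight-plotkin-invariant (leaf false) (leaf l) (leaf true) = refl
weight-plotkin-invariant (leaf true) (leaf false) (leaf false) = refl
weight-plotkin-invariant (leaf true) (leaf false) (leaf true) = refl
weight-plotkin-invariant (leaf true) (leaf true) (leaf false) = refl
weight-plotkin-invariant (leaf true) (leaf true) (leaf true) = refl
weight-plotkin-invariant (node R R′) (node l l′) (node Q Q′) = begin
  (weight (R · l ⊕ Q) + weight (R′ · l′ ⊕ Q′))
    + (weight (R · l ⊕ Q ⊕ R) + weight (R′ · l′ ⊕ Q′ ⊕ R′))
    ≡⟨ interchange (weight (R · l ⊕ Q)) _ _ _ ⟩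
  (weight (R · l ⊕ Q) + weight (R · l ⊕ Q ⊕ R))
    + (weight (R′ · l′ ⊕ Q′) + weight (R′ · l′ ⊕ Q′ ⊕ R′))
    ≡⟨ cong₂ _+_ (weight-plotkin-invariant R l Q) (weight-plotkin-invariant R′ l′ Q′) ⟩
  (weight Q + weight (Q ⊕ R)) + (weight Q′ + weight (Q′ ⊕ R′))
    ≡⟨ interchange (weight Q) _ _ _ ⟩
  (weight Q + weight Q′) + (weight (Q ⊕ R) + weight (Q′ ⊕ R′)) ∎

weightCount : ℕ → (m : ℕ) → ℕ → ℕ
weightCount r m k = ∑deg< (suc r) m (λ Q → ⟦ weight Q ≡ᵇ k ⟧)

pairCount : ℕ → ℕ → Fun m → ℕ
pairCount {m} r k R = ∑deg< (suc r) m (λ a → ⟦ weight (node a (a ⊕ R)) ≡ᵇ k ⟧)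

offDiagonal : ℕ → ℕ → Fun m → ℕ
offDiagonal r k R = if isZero R then 0 else (if deg<ᵇ r R then pairCount r k R else 0)

atSquare-cong : ∀ {f g : ℕ → ℕ} → (∀ j → f j ≡ g j) → ∀ k → atSquare f k ≡ atSquare g k
atSquare-cong eq zero = eq zero
atSquare-cong eq (suc zero) = refl
atSquare-cong eq (suc (suc k)) = atSquare-cong (λ j → eq (suc j)) k

atSquare-zero : ∀ k → atSquare (λ _ → 0) k ≡ 0
atSquare-zero zero = refl
atSquare-zero (suc zero) = refl
atSquare-zero (suc (suc k)) = atSquare-zero k

atSquare-if : ∀ c (f : ℕ → ℕ) k →
  atSquare (λ j → if c then f j else 0) k ≡ (if c then atSquare f k else 0)
atSquare-if true f k = refl
atSquare-if false f k = atSquare-zero k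

atSquare-∑ : ∀ m (F : Fun m → ℕ → ℕ) k →
  atSquare (λ j → ∑ m (λ x → F x j)) k ≡ ∑ m (λ x → atSquare (F x) k)
atSquare-∑ m F zero = refl
atSquare-∑ m F (suc zero) = sym (∑-zero m)
atSquare-∑ m F (suc (suc k)) = atSquare-∑ m (λ x j → F x (suc j)) k

⟦double≡ᵇ⟧ : ∀ w k → ⟦ w + w ≡ᵇ k ⟧ ≡ atSquare (λ j → ⟦ w ≡ᵇ j ⟧) k
⟦double≡ᵇ⟧ zero zero = refl
⟦double≡ᵇ⟧ zero (suc zero) = refl
⟦double≡ᵇ⟧ zero (suc (suc k)) = sym (atSquare-zero k)
⟦double≡ᵇ⟧ (suc w) zero = refl
⟦double≡ᵇ⟧ (suc w) (suc zero) rewrite +-suc w w = refl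
⟦double≡ᵇ⟧ (suc w) (suc (suc k)) rewrite +-suc w w = ⟦double≡ᵇ⟧ w k

pairCount-zeros : ∀ r m k → pairCount r k (zeros {m}) ≡ atSquare (weightCount r m) k
pairCount-zeros r m k = begin
  ∑deg< (suc r) m (λ a → ⟦ weight a + weight (a ⊕ zeros) ≡ᵇ k ⟧)
    ≡⟨ ∑deg<-cong (suc r) m (λ a → cong (λ b → ⟦ weight a + weight b ≡ᵇ k ⟧) (⊕-identityʳ a)) ⟩
  ∑deg< (suc r) m (λ a → ⟦ weight a + weight a ≡ᵇ k ⟧)
    ≡⟨ ∑deg<-cong (suc r) m (λ a → ⟦double≡ᵇ⟧ (weight a) k) ⟩
  ∑deg< (suc r) m (λ a → atSquare (λ j → ⟦ weight a ≡ᵇ j ⟧) k)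
    ≡⟨ ∑-cong m (λ a → atSquare-if (deg<ᵇ (suc r) a) _ k) ⟨
  ∑ m (λ a → atSquare (λ j → if deg<ᵇ (suc r) a then ⟦ weight a ≡ᵇ j ⟧ else 0) k)
    ≡⟨ atSquare-∑ m _ k ⟨
  atSquare (weightCount r m) k ∎

weightCount-decomposition : ∀ r m k →
  weightCount r (suc m) k ≡ atSquare (weightCount r m) k + ∑ m (offDiagonal r k)
weightCount-decomposition r m k = begin
  weightCount r (suc m) k
    ≡⟨ ∑deg<-plotkin r m (λ Q → ⟦ weight Q ≡ᵇ k ⟧) ⟩
  ∑deg< (suc r) m (λ a → ∑deg< r m (λ R → ⟦ weight (node a (a ⊕ R)) ≡ᵇ k ⟧))
    ≡⟨ ∑deg<-comm (suc r) r m m _ ⟩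
  ∑deg< r m (pairCount r k)
    ≡⟨ ∑-split m _ ⟩
  (if deg<ᵇ r (zeros {m}) then pairCount r k (zeros {m}) else 0) + ∑ m (offDiagonal r k)
    ≡⟨ cong (λ c → (if c then pairCount r k (zeros {m}) else 0) + ∑ m (offDiagonal r k)) (deg<-zeros {m} r) ⟩
  pairCount r k (zeros {m}) + ∑ m (offDiagonal r k)
    ≡⟨ cong (_+ ∑ m (offDiagonal r k)) (pairCount-zeros r m k) ⟩
  atSquare (weightCount r m) k + ∑ m (offDiagonal r k) ∎

pairCount-translate : ∀ r k (t : Point m) R → pairCount r k (translate t R) ≡ pairCount r k R
pairCount-translate {m} r k t R = begin
  ∑ m (λ a → if deg<ᵇ (suc r) a then ⟦ weight (node a (a ⊕ translate t R)) ≡ᵇ k ⟧ else 0)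
    ≡⟨ ∑-translate m t _ ⟨
  ∑ m (λ a → if deg<ᵇ (suc r) (translate t a) then ⟦ pairWeight (translate t a) ≡ᵇ k ⟧ else 0)
    ≡⟨ ∑-cong m (λ a → cong₂ (λ c w → if c then ⟦ w ≡ᵇ k ⟧ else 0)
                             (deg<-translate (suc r) t a) (weights a)) ⟩
  ∑ m (λ a → if deg<ᵇ (suc r) a then ⟦ weight (node a (a ⊕ R)) ≡ᵇ k ⟧ else 0) ∎
  where
  pairWeight : Fun m → ℕ
  pairWeight a = weight (node a (a ⊕ translate t R))
  weights : ∀ a → pairWeight (translate t a) ≡ weight (node a (a ⊕ R))
  weights a = cong₂ _+_ (weight-translate t a)
                        (trans (cong weight (sym (translate-⊕ t a R))) (weight-translate t (a ⊕ R)))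

2^rank∣pairCount : ∀ r k (R : Fun m) → deg<ᵇ r R ≡ true → 2 ^ rank R ∣ℕ pairCount r k R
2^rank∣pairCount r k R hR = 2^rank∣∑ R _ invariant
  where
  invariant : Invariant-·RM₁ R (λ a → if deg<ᵇ (suc r) a then ⟦ weight (node a (a ⊕ R)) ≡ᵇ k ⟧ else 0)
  invariant l hl a = cong₂ (λ c w → if c then ⟦ w ≡ᵇ k ⟧ else 0)
    (deg<-⊕-invariant (suc r) (R · l) a (deg<-· r R l hR hl)) (weight-plotkin-invariant R l a)

2^[1+m]∣∑offDiagonal : ∀ r m k → 2 ^ suc m ∣ℕ ∑ m (offDiagonal r k)
2^[1+m]∣∑offDiagonal r m k = 2^[j+1+m]∣∑ m 0 (offDiagonal r k) vanishes invariant divisible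
  where
  vanishes : offDiagonal r k (zeros {m}) ≡ 0
  vanishes rewrite isZero-zeros {m} = refl
  invariant : TranslationInvariant (offDiagonal r k)
  invariant t R rewrite isZero-translate t R | deg<-translate r t R | pairCount-translate r k t R =
    refl
  divisible : ∀ R → isZero R ≡ false → 2 ^ rank R ∣ℕ offDiagonal r k R
  divisible R nz rewrite nz with deg<ᵇ r R in hR
  ... | true = 2^rank∣pairCount r k R hR
  ... | false = _ ∣0

-- Comparison with the polynomial definition of RM(r, m)

filter-map : ∀ {A B : Set} {P : B → Set} (P? : Decidable P) (f : A → B) (xs : List A) →
  filter P? (map f xs) ≡ map f (filter (P? ∘ f) xs)
filter-map P? f [] = refl
filter-map P? f (x ∷ xs) with does (P? (f x))
... | true = cong (f x ∷_) (filter-map P? f xs)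
... | false = filter-map P? f xs

monomials-zero-suc : ∀ m → monomials 0 (suc m) ≡ map (false ∷_) (monomials 0 m)
monomials-zero-suc m = begin
  filter (λ S → wt S ≤? 0) (map (false ∷_) (allBits m) ++ map (true ∷_) (allBits m))
    ≡⟨ filter-++ (λ S → wt S ≤? 0) (map (false ∷_) (allBits m)) _ ⟩
  filter (λ S → wt S ≤? 0) (map (false ∷_) (allBits m))
    ++ filter (λ S → wt S ≤? 0) (map (true ∷_) (allBits m))
    ≡⟨ cong₂ _++_ (filter-map (λ S → wt S ≤? 0) (false ∷_) (allBits m))
                  (trans (filter-map (λ S → wt S ≤? 0) (true ∷_) (allBits m))
                         (cong (map (true ∷_))
                               (filter-none (λ S → suc (wt S) ≤? 0) (All.universal (λ _ ()) (allBits m))))) ⟩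
  map (false ∷_) (monomials 0 m) ++ []
    ≡⟨ ++-identityʳ _ ⟩
  map (false ∷_) (monomials 0 m) ∎

monomials-suc : ∀ r m →
  monomials (suc r) (suc m) ≡ map (false ∷_) (monomials (suc r) m) ++ map (true ∷_) (monomials r m)
monomials-suc r m = begin
  filter (λ S → wt S ≤? suc r) (map (false ∷_) (allBits m) ++ map (true ∷_) (allBits m))
    ≡⟨ filter-++ (λ S → wt S ≤? suc r) (map (false ∷_) (allBits m)) _ ⟩
  filter (λ S → wt S ≤? suc r) (map (false ∷_) (allBits m))
    ++ filter (λ S → wt S ≤? suc r) (map (true ∷_) (allBits m))
    ≡⟨ cong₂ _++_ (filter-map (λ S → wt S ≤? suc r) (false ∷_) (allBits m))
                  (trans (filter-map (λ S → wt S ≤? suc r) (true ∷_) (allBits m))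
                         (cong (map (true ∷_)) (filter-≐ _ (λ S → wt S ≤? r) (s≤s⁻¹ , s≤s) (allBits m)))) ⟩
  map (false ∷_) (monomials (suc r) m) ++ map (true ∷_) (monomials r m) ∎

evalPoly-++ : ∀ c₁ c₂ M₁ M₂ a → length c₁ ≡ length M₁ →
  evalPoly (c₁ ++ c₂) (M₁ ++ M₂) a ≡ evalPoly c₁ M₁ a xor evalPoly c₂ M₂ a
evalPoly-++ [] c₂ [] M₂ a _ = refl
evalPoly-++ (c ∷ c₁) c₂ (S ∷ M₁) M₂ a len =
  trans (cong ((c ∧ evalMono S a) xor_) (evalPoly-++ c₁ c₂ M₁ M₂ a (suc-injective len)))
        (sym (xor-assoc (c ∧ evalMono S a) _ _))

evalPoly-false∷ : ∀ cs M x a → evalPoly cs (map (false ∷_) M) (x ∷ a) ≡ evalPoly cs M a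
evalPoly-false∷ [] M x a = refl
evalPoly-false∷ (c ∷ cs) [] x a = refl
evalPoly-false∷ (c ∷ cs) (S ∷ M) x a = cong ((c ∧ evalMono S a) xor_) (evalPoly-false∷ cs M x a)

evalPoly-true∷ : ∀ cs M x a → evalPoly cs (map (true ∷_) M) (x ∷ a) ≡ x ∧ evalPoly cs M a
evalPoly-true∷ [] M x a = sym (∧-zeroʳ x)
evalPoly-true∷ (c ∷ cs) [] x a = sym (∧-zeroʳ x)
evalPoly-true∷ (c ∷ cs) (S ∷ M) true a = cong ((c ∧ evalMono S a) xor_) (evalPoly-true∷ cs M true a)
evalPoly-true∷ (c ∷ cs) (S ∷ M) false a rewrite ∧-zeroʳ c = evalPoly-true∷ cs M false a

codeword : ℕ → (m : ℕ) → List Bool → List Bool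
codeword r m cs = valueVector m cs (monomials r m)

dim : ℕ → ℕ → ℕ
dim r m = length (monomials r m)

dim-zero-suc : ∀ m → dim 0 (suc m) ≡ dim 0 m
dim-zero-suc m = trans (cong length (monomials-zero-suc m)) (length-map (false ∷_) (monomials 0 m))

dim-suc : ∀ r m → dim (suc r) (suc m) ≡ dim (suc r) m + dim r m
dim-suc r m = begin
  length (monomials (suc r) (suc m))
    ≡⟨ cong length (monomials-suc r m) ⟩
  length (map (false ∷_) (monomials (suc r) m) ++ map (true ∷_) (monomials r m))
    ≡⟨ length-++ (map (false ∷_) (monomials (suc r) m)) ⟩
  length (map (false ∷_) (monomials (suc r) m)) + length (map (true ∷_) (monomials r m))
    ≡⟨ cong₂ _+_ (length-map (false ∷_) (monomials (suc r) m)) (length-map (true ∷_) (monomials r m)) ⟩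
  dim (suc r) m + dim r m ∎

length-codeword : ∀ r m cs → length (codeword r m cs) ≡ length (allBits m)
length-codeword r m cs = length-map (evalPoly cs (monomials r m)) (allBits m)

codeword-base : ∀ r c → codeword r 0 (c ∷ []) ≡ c ∷ []
codeword-base r true = refl
codeword-base r false = refl

map-allBits-suc : ∀ {A : Set} m (f : List Bool → A) →
  map f (allBits (suc m)) ≡ map (f ∘ (false ∷_)) (allBits m) ++ map (f ∘ (true ∷_)) (allBits m)
map-allBits-suc m f = trans (map-++ f (map (false ∷_) (allBits m)) _)
                            (sym (cong₂ _++_ (map-∘ (allBits m)) (map-∘ (allBits m))))

codeword-zero-suc : ∀ m cs → codeword 0 (suc m) cs ≡ codeword 0 m cs ++ codeword 0 m cs
codeword-zero-suc m cs rewrite monomials-zero-suc m =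
  trans (map-allBits-suc m (evalPoly cs (map (false ∷_) (monomials 0 m))))
        (cong₂ _++_ (map-cong (λ a → evalPoly-false∷ cs (monomials 0 m) false a) (allBits m))
                    (map-cong (λ a → evalPoly-false∷ cs (monomials 0 m) true a) (allBits m)))

zipWith-map-diag : ∀ {A : Set} (_∙_ : Bool → Bool → Bool) (f g : A → Bool) xs →
  zipWith _∙_ (map f xs) (map g xs) ≡ map (λ x → f x ∙ g x) xs
zipWith-map-diag _∙_ f g [] = refl
zipWith-map-diag _∙_ f g (x ∷ xs) = cong ((f x ∙ g x) ∷_) (zipWith-map-diag _∙_ f g xs)

codeword-suc : ∀ r m c₁ c₂ → length c₁ ≡ dim (suc r) m →
  codeword (suc r) (suc m) (c₁ ++ c₂)
    ≡ codeword (suc r) m c₁ ++ zipWith _xor_ (codeword (suc r) m c₁) (codeword r m c₂)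
codeword-suc r m c₁ c₂ len rewrite monomials-suc r m =
  trans (map-allBits-suc m P)
        (cong₂ _++_ (map-cong at-false (allBits m))
                    (trans (map-cong at-true (allBits m)) (sym (zipWith-map-diag _xor_ _ _ (allBits m)))))
  where
  M₁ : List (List Bool)
  M₁ = monomials (suc r) m
  M₂ : List (List Bool)
  M₂ = monomials r m
  P : List Bool → Bool
  P = evalPoly (c₁ ++ c₂) (map (false ∷_) M₁ ++ map (true ∷_) M₂)
  len′ : length c₁ ≡ length (map (false ∷_) M₁)
  len′ = trans len (sym (length-map _ M₁))
  at-false : ∀ a → P (false ∷ a) ≡ evalPoly c₁ M₁ a
  at-false a = begin
    P (false ∷ a)
      ≡⟨ evalPoly-++ c₁ c₂ _ _ (false ∷ a) len′ ⟩
    evalPoly c₁ (map (false ∷_) M₁) (false ∷ a) xor evalPoly c₂ (map (true ∷_) M₂) (false ∷ a)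
      ≡⟨ cong₂ _xor_ (evalPoly-false∷ c₁ M₁ false a) (evalPoly-true∷ c₂ M₂ false a) ⟩
    evalPoly c₁ M₁ a xor false
      ≡⟨ xor-identityʳ _ ⟩
    evalPoly c₁ M₁ a ∎
  at-true : ∀ a → P (true ∷ a) ≡ evalPoly c₁ M₁ a xor evalPoly c₂ M₂ a
  at-true a = trans (evalPoly-++ c₁ c₂ _ _ (true ∷ a) len′)
                    (cong₂ _xor_ (evalPoly-false∷ c₁ M₁ true a) (evalPoly-true∷ c₂ M₂ true a))

flatten : Fun m → List Bool
flatten (leaf b) = b ∷ []
flatten (node a b) = flatten a ++ flatten b

length-flatten : (a b : Fun m) → length (flatten a) ≡ length (flatten b)
length-flatten (leaf _) (leaf _) = refl
length-flatten (node a a′) (node b b′)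
  rewrite length-++ (flatten a) {flatten a′} | length-++ (flatten b) {flatten b′} =
  cong₂ _+_ (length-flatten a b) (length-flatten a′ b′)

zipWith-++ : ∀ (_∙_ : Bool → Bool → Bool) (xs ys xs′ ys′ : List Bool) → length xs ≡ length ys →
  zipWith _∙_ (xs ++ xs′) (ys ++ ys′) ≡ zipWith _∙_ xs ys ++ zipWith _∙_ xs′ ys′
zipWith-++ _∙_ [] [] xs′ ys′ _ = refl
zipWith-++ _∙_ (x ∷ xs) (y ∷ ys) xs′ ys′ len =
  cong ((x ∙ y) ∷_) (zipWith-++ _∙_ xs ys xs′ ys′ (suc-injective len))

flatten-⊕ : (a b : Fun m) → flatten (a ⊕ b) ≡ zipWith _xor_ (flatten a) (flatten b)
flatten-⊕ (leaf a) (leaf b) = refl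
flatten-⊕ (node a a′) (node b b′) =
  trans (cong₂ _++_ (flatten-⊕ a b) (flatten-⊕ a′ b′))
        (sym (zipWith-++ _xor_ (flatten a) (flatten b) _ _ (length-flatten a b)))

wt-++ : ∀ xs ys → wt (xs ++ ys) ≡ wt xs + wt ys
wt-++ [] ys = refl
wt-++ (false ∷ xs) ys = wt-++ xs ys
wt-++ (true ∷ xs) ys = cong suc (wt-++ xs ys)

wt-flatten : (a : Fun m) → wt (flatten a) ≡ weight a
wt-flatten (leaf false) = refl
wt-flatten (leaf true) = refl
wt-flatten (node a b) = trans (wt-++ (flatten a) (flatten b)) (cong₂ _+_ (wt-flatten a) (wt-flatten b))

∑Bits : (n : ℕ) → (List Bool → ℕ) → ℕ
∑Bits n h = sum (map h (allBits n))

∑Bits-suc : ∀ n (h : List Bool → ℕ) →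
  ∑Bits (suc n) h ≡ ∑Bits n (h ∘ (false ∷_)) + ∑Bits n (h ∘ (true ∷_))
∑Bits-suc n h = trans (cong sum (map-allBits-suc n h)) (sum-++ (map (h ∘ (false ∷_)) (allBits n)) _)

∑Bits-cong : ∀ n {h h′ : List Bool → ℕ} → (∀ c → length c ≡ n → h c ≡ h′ c) →
  ∑Bits n h ≡ ∑Bits n h′
∑Bits-cong zero eq = cong (_+ 0) (eq [] refl)
∑Bits-cong (suc n) {h} {h′} eq = begin
  ∑Bits (suc n) h
    ≡⟨ ∑Bits-suc n h ⟩
  ∑Bits n (h ∘ (false ∷_)) + ∑Bits n (h ∘ (true ∷_))
    ≡⟨ cong₂ _+_ (∑Bits-cong n (λ c len → eq (false ∷ c) (cong suc len)))
                 (∑Bits-cong n (λ c len → eq (true ∷ c) (cong suc len))) ⟩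
  ∑Bits n (h′ ∘ (false ∷_)) + ∑Bits n (h′ ∘ (true ∷_))
    ≡⟨ ∑Bits-suc n h′ ⟨
  ∑Bits (suc n) h′ ∎

∑Bits-+ : ∀ n₁ n₂ (h : List Bool → ℕ) →
  ∑Bits (n₁ + n₂) h ≡ ∑Bits n₁ (λ c₁ → ∑Bits n₂ (λ c₂ → h (c₁ ++ c₂)))
∑Bits-+ zero n₂ h = sym (+-identityʳ _)
∑Bits-+ (suc n₁) n₂ h = begin
  ∑Bits (suc (n₁ + n₂)) h
    ≡⟨ ∑Bits-suc (n₁ + n₂) h ⟩
  ∑Bits (n₁ + n₂) (h ∘ (false ∷_)) + ∑Bits (n₁ + n₂) (h ∘ (true ∷_))
    ≡⟨ cong₂ _+_ (∑Bits-+ n₁ n₂ (h ∘ (false ∷_))) (∑Bits-+ n₁ n₂ (h ∘ (true ∷_))) ⟩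
  ∑Bits n₁ (λ c₁ → ∑Bits n₂ (λ c₂ → h (false ∷ c₁ ++ c₂)))
    + ∑Bits n₁ (λ c₁ → ∑Bits n₂ (λ c₂ → h (true ∷ c₁ ++ c₂)))
    ≡⟨ ∑Bits-suc n₁ (λ c₁ → ∑Bits n₂ (λ c₂ → h (c₁ ++ c₂))) ⟨
  ∑Bits (suc n₁) (λ c₁ → ∑Bits n₂ (λ c₂ → h (c₁ ++ c₂))) ∎

-- Both sides follow the Plotkin recursion: codeword-suc on the left, ∑deg<-plotkin on the right.
∑Bits-codeword : ∀ r m (f : List Bool → ℕ) →
  ∑Bits (dim r m) (f ∘ codeword r m) ≡ ∑deg< (suc r) m (f ∘ flatten)
∑Bits-codeword r zero f = cong (λ n → f (false ∷ []) + n) (+-identityʳ _)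
∑Bits-codeword zero (suc m) f = begin
  ∑Bits (dim 0 (suc m)) (f ∘ codeword 0 (suc m))
    ≡⟨ ∑Bits-cong (dim 0 (suc m)) (λ cs _ → cong f (codeword-zero-suc m cs)) ⟩
  ∑Bits (dim 0 (suc m)) (λ cs → f (codeword 0 m cs ++ codeword 0 m cs))
    ≡⟨ cong (λ n → ∑Bits n (λ cs → f (codeword 0 m cs ++ codeword 0 m cs))) (dim-zero-suc m) ⟩
  ∑Bits (dim 0 m) (λ cs → f (codeword 0 m cs ++ codeword 0 m cs))
    ≡⟨ ∑Bits-codeword 0 m (λ v → f (v ++ v)) ⟩
  ∑deg< 1 m (λ a → f (flatten a ++ flatten a))
    ≡⟨ ∑deg<-cong 1 m (λ a → trans (∑-atZero m _) (cong (λ b → f (flatten a ++ flatten b)) (⊕-identityʳ a)))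
     ⟨
  ∑deg< 1 m (λ a → ∑deg< 0 m (λ b → f (flatten (node a (a ⊕ b)))))
    ≡⟨ ∑deg<-plotkin 0 m (f ∘ flatten) ⟨
  ∑deg< 1 (suc m) (f ∘ flatten) ∎
∑Bits-codeword (suc r) (suc m) f = begin
  ∑Bits (dim (suc r) (suc m)) (f ∘ codeword (suc r) (suc m))
    ≡⟨ cong (λ n → ∑Bits n (f ∘ codeword (suc r) (suc m))) (dim-suc r m) ⟩
  ∑Bits (n₁ + n₂) (f ∘ codeword (suc r) (suc m))
    ≡⟨ ∑Bits-+ n₁ n₂ _ ⟩
  ∑Bits n₁ (λ c₁ → ∑Bits n₂ (λ c₂ → f (codeword (suc r) (suc m) (c₁ ++ c₂))))
    ≡⟨ ∑Bits-cong n₁ (λ c₁ len → ∑Bits-cong n₂ (λ c₂ _ → cong f (codeword-suc r m c₁ c₂ len))) ⟩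
  ∑Bits n₁ (λ c₁ → ∑Bits n₂ (λ c₂ → g (codeword (suc r) m c₁) (codeword r m c₂)))
    ≡⟨ ∑Bits-codeword (suc r) m (λ u → ∑Bits n₂ (λ c₂ → g u (codeword r m c₂))) ⟩
  ∑deg< (suc (suc r)) m (λ a → ∑Bits n₂ (λ c₂ → g (flatten a) (codeword r m c₂)))
    ≡⟨ ∑deg<-cong (suc (suc r)) m (λ a → ∑Bits-codeword r m (g (flatten a))) ⟩
  ∑deg< (suc (suc r)) m (λ a → ∑deg< (suc r) m (λ b → g (flatten a) (flatten b)))
    ≡⟨ ∑deg<-cong (suc (suc r)) m (λ a →
         ∑deg<-cong (suc r) m (λ b → cong (λ w → f (flatten a ++ w)) (flatten-⊕ a b))) ⟨
  ∑deg< (suc (suc r)) m (λ a → ∑deg< (suc r) m (λ b → f (flatten (node a (a ⊕ b)))))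
    ≡⟨ ∑deg<-plotkin (suc r) m (f ∘ flatten) ⟨
  ∑deg< (suc (suc r)) (suc m) (f ∘ flatten) ∎
  where
  n₁ : ℕ
  n₁ = dim (suc r) m
  n₂ : ℕ
  n₂ = dim r m
  g : List Bool → List Bool → ℕ
  g u w = f (u ++ zipWith _xor_ u w)

++-injective : ∀ (xs ys xs′ ys′ : List Bool) → length xs ≡ length xs′ →
  xs ++ ys ≡ xs′ ++ ys′ → xs ≡ xs′ × ys ≡ ys′
++-injective [] ys [] ys′ _ eq = refl , eq
++-injective (x ∷ xs) ys (x′ ∷ xs′) ys′ len eq with ∷-injective eq
... | refl , eq′ with ++-injective xs ys xs′ ys′ (suc-injective len) eq′
... | refl , refl = refl , refl

zipWith-xor-cancelˡ : ∀ (u w w′ : List Bool) → length w ≡ length u → length w′ ≡ length u →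
  zipWith _xor_ u w ≡ zipWith _xor_ u w′ → w ≡ w′
zipWith-xor-cancelˡ [] [] [] _ _ _ = refl
zipWith-xor-cancelˡ (x ∷ u) (y ∷ w) (y′ ∷ w′) len len′ eq =
  cong₂ _∷_ (xor-cancelˡ x y y′ (∷-injectiveˡ eq))
            (zipWith-xor-cancelˡ u w w′ (suc-injective len) (suc-injective len′) (∷-injectiveʳ eq))
  where
  xor-cancelˡ : ∀ x y y′ → x xor y ≡ x xor y′ → y ≡ y′
  xor-cancelˡ false y y′ e = e
  xor-cancelˡ true false false _ = refl
  xor-cancelˡ true true true _ = refl

++-split : ∀ n₁ n₂ (cs : List Bool) → length cs ≡ n₁ + n₂ →
  ∃ λ c₁ → ∃ λ c₂ → cs ≡ c₁ ++ c₂ × length c₁ ≡ n₁ × length c₂ ≡ n₂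
++-split zero n₂ cs len = [] , cs , refl , refl , len
++-split (suc n₁) n₂ (c ∷ cs) len with ++-split n₁ n₂ cs (suc-injective len)
... | c₁ , c₂ , refl , len₁ , len₂ = c ∷ c₁ , c₂ , refl , cong suc len₁ , len₂

codeword-injective : ∀ r m cs cs′ → length cs ≡ dim r m → length cs′ ≡ dim r m →
  codeword r m cs ≡ codeword r m cs′ → cs ≡ cs′
codeword-injective r zero (c ∷ []) (c′ ∷ []) _ _ eq =
  trans (sym (codeword-base r c)) (trans eq (codeword-base r c′))
codeword-injective zero (suc m) cs cs′ len len′ eq =
  codeword-injective 0 m cs cs′ (trans len (dim-zero-suc m)) (trans len′ (dim-zero-suc m))
    (proj₁ (++-injective (codeword 0 m cs) _ (codeword 0 m cs′) _
             (trans (length-codeword 0 m cs) (sym (length-codeword 0 m cs′)))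
             (trans (sym (codeword-zero-suc m cs)) (trans eq (codeword-zero-suc m cs′)))))
codeword-injective (suc r) (suc m) cs cs′ len len′ eq
  with ++-split (dim (suc r) m) (dim r m) cs (trans len (dim-suc r m))
     | ++-split (dim (suc r) m) (dim r m) cs′ (trans len′ (dim-suc r m))
... | c₁ , c₂ , refl , len₁ , len₂ | c₁′ , c₂′ , refl , len₁′ , len₂′
  with ++-injective (codeword (suc r) m c₁) _ (codeword (suc r) m c₁′) _
         (trans (length-codeword (suc r) m c₁) (sym (length-codeword (suc r) m c₁′)))
         (trans (sym (codeword-suc r m c₁ c₂ len₁)) (trans eq (codeword-suc r m c₁′ c₂′ len₁′)))
... | eq₁ , eq₂ = cong₂ _++_
  (codeword-injective (suc r) m c₁ c₁′ len₁ len₁′ eq₁)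
  (codeword-injective r m c₂ c₂′ len₂ len₂′
    (zipWith-xor-cancelˡ (codeword (suc r) m c₁) _ _
      (trans (length-codeword r m c₂) (sym (length-codeword (suc r) m c₁)))
      (trans (length-codeword r m c₂′) (sym (length-codeword (suc r) m c₁)))
      (trans eq₂ (cong (λ u → zipWith _xor_ u (codeword r m c₂′)) (sym eq₁)))))

allBits-length : ∀ n → All (λ c → length c ≡ n) (allBits n)
allBits-length zero = refl ∷ []
allBits-length (suc n) =
  All.++⁺ (All.map⁺ (All.map (cong suc) (allBits-length n)))
          (All.map⁺ (All.map (cong suc) (allBits-length n)))

allBits-unique : ∀ n → Unique (allBits n)
allBits-unique zero = [] ∷ []
allBits-unique (suc n) =
  Unique.++⁺ (Unique.map⁺ ∷-injectiveʳ (allBits-unique n)) (Unique.map⁺ ∷-injectiveʳ (allBits-unique n)) disjoint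
  where
  disjoint : Disjoint (map (false ∷_) (allBits n)) (map (true ∷_) (allBits n))
  disjoint (p , q) with ∈-map⁻ (false ∷_) p | ∈-map⁻ (true ∷_) q
  ... | _ , _ , refl | _ , _ , ()

unique-map-injectiveOn : ∀ {A B : Set} {P : A → Set} (f : A → B) →
  (∀ {x y} → P x → P y → f x ≡ f y → x ≡ y) → ∀ {xs} → All P xs → Unique xs → Unique (map f xs)
unique-map-injectiveOn f inj [] [] = []
unique-map-injectiveOn f inj (px ∷ pxs) (x∉ ∷ u) =
  All.map⁺ (All.zipWith (λ (x≢y , py) fx≡fy → x≢y (inj px py fx≡fy)) (x∉ , pxs))
    ∷ unique-map-injectiveOn f inj pxs u

deduplicate-unique : ∀ {xs : List (List Bool)} → Unique xs → deduplicate (≡-dec _≟ᴮ_) xs ≡ xs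
deduplicate-unique [] = refl
deduplicate-unique {x ∷ _} (x∉ ∷ u) rewrite deduplicate-unique u =
  cong (x ∷_) (filter-all (¬? ∘ ≡-dec _≟ᴮ_ x) x∉)

length-filter-wt : ∀ k xs → length (filter (λ c → wt c ≟ k) xs) ≡ sum (map (λ c → ⟦ wt c ≡ᵇ k ⟧) xs)
length-filter-wt k [] = refl
length-filter-wt k (x ∷ xs) with wt x ≡ᵇ k
... | true = cong suc (length-filter-wt k xs)
... | false = length-filter-wt k xs

W≡weightCount : ∀ r m k → W r m k ≡ weightCount r m k
W≡weightCount r m k = begin
  length (filter (λ c → wt c ≟ k) (deduplicate (≡-dec _≟ᴮ_) codewords))
    ≡⟨ cong (λ cs → length (filter (λ c → wt c ≟ k) cs)) (deduplicate-unique codewords-unique) ⟩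
  length (filter (λ c → wt c ≟ k) codewords)
    ≡⟨ length-filter-wt k codewords ⟩
  sum (map (λ c → ⟦ wt c ≡ᵇ k ⟧) codewords)
    ≡⟨ cong sum (map-∘ (allBits (dim r m))) ⟨
  ∑Bits (dim r m) (λ cs → ⟦ wt (codeword r m cs) ≡ᵇ k ⟧)
    ≡⟨ ∑Bits-codeword r m (λ c → ⟦ wt c ≡ᵇ k ⟧) ⟩
  ∑deg< (suc r) m (λ Q → ⟦ wt (flatten Q) ≡ᵇ k ⟧)
    ≡⟨ ∑deg<-cong (suc r) m (λ Q → cong (λ w → ⟦ w ≡ᵇ k ⟧) (wt-flatten Q)) ⟩
  weightCount r m k ∎
  where
  codewords : List (List Bool)
  codewords = map (codeword r m) (allBits (dim r m))
  codewords-unique : Unique codewords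
  codewords-unique = unique-map-injectiveOn (codeword r m) (codeword-injective r m _ _)
                       (allBits-length (dim r m)) (allBits-unique (dim r m))

+[m+n]-+m≡+n : ∀ m n → + (m + n) - + m ≡ + n
+[m+n]-+m≡+n m n = begin
  + (m + n) - + m       ≡⟨ [+m]-[+n]≡m⊖n (m + n) m ⟩
  (m + n) ⊖ m           ≡⟨ cong ((m + n) ⊖_) (+-identityʳ m) ⟨
  (m + n) ⊖ (m + 0)     ≡⟨ +-cancelˡ-⊖ m n 0 ⟩
  + n                   ∎

theorem13 : (m r : ℕ) → r ≤ suc m → (k : ℕ) →
    (+ (2 ^ suc m)) ∣ ((+ W r (suc m) k) - (+ atSquare (W r m) k))
theorem13 m r _ k = subst (+ (2 ^ suc m) ∣_) (sym difference) (2^[1+m]∣∑offDiagonal r m k)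
  where
  difference : + W r (suc m) k - + atSquare (W r m) k ≡ + ∑ m (offDiagonal r k)
  difference = begin
    + W r (suc m) k - + atSquare (W r m) k
      ≡⟨ cong₂ (λ x y → + x - + y) (W≡weightCount r (suc m) k) (atSquare-cong (W≡weightCount r m) k) ⟩
    + weightCount r (suc m) k - + atSquare (weightCount r m) k
      ≡⟨ cong (λ x → + x - + atSquare (weightCount r m) k) (weightCount-decomposition r m k) ⟩
    + (atSquare (weightCount r m) k + ∑ m (offDiagonal r k)) - + atSquare (weightCount r m) k
      ≡⟨ +[m+n]-+m≡+n (atSquare (weightCount r m) k) (∑ m (offDiagonal r k)) ⟩
    + ∑ m (offDiagonal r k) ∎
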